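{- Let $p$ be a prime and $A=\begin{pmatrix}p&0\\0&1\end{pmatrix}$. Let $H\subset\mathrm{SL}_2(\mathbf{Z})$ be a finite index subgroup containing $-I$ with Wohlfahrt level $L(H)=N$. Then $L(A^{ -1}HA\cap\mathrm{SL}_2(\mathbf{Z}))$ divides $Np$.
   Context: For a finite index subgroup $G\subset\mathrm{SL}_2(\mathbf{Z})$ and $\zeta\in\mathbf{P}^1(\mathbf{Q})$, pick $M\in\mathrm{SL}_2(\mathbf{Z})$ with $M\infty=\zeta$; the cusp width of $\zeta$ is the least positive integer $m$ with $\pm MU^mM^{ -1}\in G$, where $U=\begin{pmatrix}1&1\\0&1\end{pmatrix}$. The Wohlfahrt level $L(G)$ is the least common multiple of all cusp widths of $G$. -}

module Defs where

open import Data.Nat using (ℕ; _<_; _*_)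
open import Data.Nat.Divisibility using (_∣_)
open import Data.Integer as ℤ using (ℤ; +_; -_)
open import Data.List using (List)
open import Data.List.Relation.Unary.All using (All)
open import Data.List.Relation.Unary.Any using (Any)
open import Data.Product using (Σ; ∃; _×_)
open import Data.Sum using (_⊎_)
open import Relation.Binary.PropositionalEquality using (_≡_)
open import Relation.Nullary using (¬_)

record M2 : Set where
  constructor mat
  field
    a b c d : ℤ

open M2 public

infixl 7 _·_
_·_ : M2 → M2 → M2
mat a₁ b₁ c₁ d₁ · mat a₂ b₂ c₂ d₂ =
  mat (a₁ ℤ.* a₂ ℤ.+ b₁ ℤ.* c₂) (a₁ ℤ.* b₂ ℤ.+ b₁ ℤ.* d₂)
      (c₁ ℤ.* a₂ ℤ.+ d₁ ℤ.* c₂) (c₁ ℤ.* b₂ ℤ.+ d₁ ℤ.* d₂)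

det : M2 → ℤ
det (mat a b c d) = a ℤ.* d ℤ.- b ℤ.* c

-- adjugate; equals the inverse for matrices of determinant 1
adj : M2 → M2
adj (mat a b c d) = mat d (- b) (- c) a

neg : M2 → M2
neg (mat a b c d) = mat (- a) (- b) (- c) (- d)

I : M2
I = mat (+ 1) (+ 0) (+ 0) (+ 1)

Upow : ℕ → M2
Upow m = mat (+ 1) (+ m) (+ 0) (+ 1)

Amat : ℕ → M2
Amat p = mat (+ p) (+ 0) (+ 0) (+ 1)

SL2 : M2 → Set
SL2 g = det g ≡ + 1

IsSubgroupSL2 : (M2 → Set) → Set
IsSubgroupSL2 H =
  (∀ g → H g → SL2 g) × H I ×
  (∀ g h → H g → H h → H (g · h)) × (∀ g → H g → H (adj g))

FiniteIndex : (M2 → Set) → Set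
FiniteIndex H =
  Σ (List M2) λ reps → All SL2 reps ×
    (∀ γ → SL2 γ → Any (λ g → H (adj g · γ)) reps)

-- A⁻¹ H A ∩ SL₂(ℤ) : γ ∈ SL₂(ℤ) with γ = A⁻¹ h A for some h ∈ H, i.e. A γ = h A
ConjInter : ℕ → (M2 → Set) → M2 → Set
ConjInter p H γ = SL2 γ × ∃ λ h → H h × (Amat p · γ ≡ h · Amat p)

WidthCond : (M2 → Set) → M2 → ℕ → Set
WidthCond G M m = G (M · Upow m · adj M) ⊎ G (neg (M · Upow m · adj M))

-- m is the cusp width of the cusp M∞ (M ∈ SL₂(ℤ)): least positive m with ±MU^mM⁻¹ ∈ G
IsCuspWidth : (M2 → Set) → M2 → ℕ → Set
IsCuspWidth G M m =
  0 < m × WidthCond G M m × (∀ k → 0 < k → k < m → ¬ WidthCond G M k)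

-- N is the Wohlfahrt level: the lcm of all cusp widths
-- (every cusp width divides N, and N divides every common multiple of them)
IsWohlfahrtLevel : (M2 → Set) → ℕ → Set
IsWohlfahrtLevel G N =
  (∀ M m → SL2 M → IsCuspWidth G M m → m ∣ N) ×
  (∀ K → (∀ M m → SL2 M → IsCuspWidth G M m → m ∣ K) → N ∣ K)

{-# OPTIONS --safe #-}
module Submission where

-- For M ∈ SL₂(ℤ) with first column (a, c), M Uᵏ M⁻¹ = X(a, c, k) depends only on (a, c), and
-- k ↦ X(a, c, k) is a homomorphism from ℤ. Hence, for a group G ∋ −I, the cusp width of G at M∞
-- divides every k with X(a, c, k) ∈ G, and X(a, c, level) ∈ G. Conjugation by A = diag(p, 1)
-- turns X(a, c, pk) into X(pa, c, k). So if m is a cusp width of G = A⁻¹HA ∩ SL₂(ℤ), then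
-- X(pa, c, m) ∈ H. If p ∤ c the column (pa, c) is primitive; if c = pc′ then
-- X(pa, c, k) = X(a, c′, p²k) and (a, c′) is primitive. Either way H has a cusp there, whose width
-- divides N, so X(pa, c, N) ∈ H, i.e. X(a, c, pN) ∈ G, and therefore m ∣ pN.
-- A least cusp width exists only classically, so that step runs under double negation, which is
-- harmless because divisibility is decidable.

open import Defs
import Data.Nat.Base as ℕ
open import Data.Integer.Base as ℤ using (ℤ; +_; ∣_∣)
open import Data.Integer.Properties using (pos-*)
open import Data.Nat.Divisibility using (_∣_)
open import Data.Nat.Primality using (Prime)
open import Data.Product using (∃; ∃₂; _,_; proj₁; proj₂)
open import Data.Sum using (inj₁; inj₂)
open import Data.Empty using (⊥-elim)
open import Function using (_∘_)
open import Relation.Nullary using (¬_; yes; no)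
open import Relation.Binary.PropositionalEquality using (_≡_; refl; sym; trans; cong; cong₂; subst)
open Relation.Binary.PropositionalEquality.≡-Reasoning

module IntegerAlgebra where
  open import Data.Integer.Base using (_+_; _-_; -_; _*_; -[1+_])
  open import Data.Integer.Properties using (*-cancelʳ-≡; *-identityʳ; *-comm)
  open import Data.Integer.Tactic.RingSolver using (solve-∀)
  open import Data.Nat.Coprimality using (Coprime; coprime-Bézout)
  open import Data.Nat.GCD using (module Bézout)
  open import Data.Nat.Primality using (prime⇒irreducible)
  import Data.Integer.Divisibility.Signed as Signed

  mat-≡ : ∀ {a b c d a′ b′ c′ d′} → a ≡ a′ → b ≡ b′ → c ≡ c′ → d ≡ d′ → mat a b c d ≡ mat a′ b′ c′ d′
  mat-≡ refl refl refl refl = refl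

  ·-assoc : ∀ x y z → (x · y) · z ≡ x · (y · z)
  ·-assoc (mat a b c d) (mat e f g h) (mat i j k l) =
    mat-≡ (entry a b e f g h i k) (entry a b e f g h j l) (entry c d e f g h i k) (entry c d e f g h j l)
    where
    entry : ∀ a b e f g h i k →
            (a * e + b * g) * i + (a * f + b * h) * k ≡ a * (e * i + f * k) + b * (g * i + h * k)
    entry = solve-∀

  ·-identityˡ : ∀ x → I · x ≡ x
  ·-identityˡ (mat a b c d) = mat-≡ (upper a c) (upper b d) (lower a c) (lower b d)
    where
    upper : ∀ x y → + 1 * x + + 0 * y ≡ x
    upper = solve-∀
    lower : ∀ x y → + 0 * x + + 1 * y ≡ y
    lower = solve-∀

  ·-identityʳ : ∀ x → x · I ≡ x
  ·-identityʳ (mat a b c d) = mat-≡ (left a b) (right a b) (left c d) (right c d)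
    where
    left : ∀ x y → x * + 1 + y * + 0 ≡ x
    left = solve-∀
    right : ∀ x y → x * + 0 + y * + 1 ≡ y
    right = solve-∀

  ·-adjʳ : ∀ x → SL2 x → x · adj x ≡ I
  ·-adjʳ (mat a b c d) det≡1 =
    mat-≡ (trans (e₁₁ a b c d) det≡1) (e₁₂ a b) (e₂₁ c d) (trans (e₂₂ a b c d) det≡1)
    where
    e₁₁ : ∀ a b c d → a * d + b * (- c) ≡ a * d - b * c
    e₁₁ = solve-∀
    e₁₂ : ∀ a b → a * (- b) + b * a ≡ + 0
    e₁₂ = solve-∀
    e₂₁ : ∀ c d → c * d + d * (- c) ≡ + 0
    e₂₁ = solve-∀
    e₂₂ : ∀ a b c d → c * (- b) + d * a ≡ a * d - b * c
    e₂₂ = solve-∀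

  adj-·ˡ : ∀ x → SL2 x → adj x · x ≡ I
  adj-·ˡ (mat a b c d) det≡1 =
    mat-≡ (trans (e₁₁ a b c d) det≡1) (e₁₂ b d) (e₂₁ a c) (trans (e₂₂ a b c d) det≡1)
    where
    e₁₁ : ∀ a b c d → d * a + (- b) * c ≡ a * d - b * c
    e₁₁ = solve-∀
    e₁₂ : ∀ b d → d * b + (- b) * d ≡ + 0
    e₁₂ = solve-∀
    e₂₁ : ∀ a c → (- c) * a + a * c ≡ + 0
    e₂₁ = solve-∀
    e₂₂ : ∀ a b c d → (- c) * b + a * d ≡ a * d - b * c
    e₂₂ = solve-∀

  det-· : ∀ x y → det (x · y) ≡ det x * det y
  det-· (mat a b c d) (mat e f g h) = multiplicative a b c d e f g h
    where
    multiplicative : ∀ a b c d e f g h →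
      (a * e + b * g) * (c * f + d * h) - (a * f + b * h) * (c * e + d * g) ≡ (a * d - b * c) * (e * h - f * g)
    multiplicative = solve-∀

  det-adj : ∀ x → det (adj x) ≡ det x
  det-adj (mat a b c d) = symmetric a b c d
    where
    symmetric : ∀ a b c d → d * a - (- b) * (- c) ≡ a * d - b * c
    symmetric = solve-∀

  neg-I-·-neg : ∀ x → neg I · neg x ≡ x
  neg-I-·-neg (mat a b c d) = mat-≡ (upper a c) (upper b d) (lower a c) (lower b d)
    where
    upper : ∀ x y → (- + 1) * (- x) + + 0 * (- y) ≡ x
    upper = solve-∀
    lower : ∀ x y → + 0 * (- x) + (- + 1) * (- y) ≡ y
    lower = solve-∀

  neg-I-· : ∀ x → neg I · x ≡ neg x
  neg-I-· (mat a b c d) = mat-≡ (upper a c) (upper b d) (lower a c) (lower b d)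
    where
    upper : ∀ x y → (- + 1) * x + + 0 * y ≡ - x
    upper = solve-∀
    lower : ∀ x y → + 0 * x + (- + 1) * y ≡ - y
    lower = solve-∀

  ·-neg-I : ∀ x → x · neg I ≡ neg x
  ·-neg-I (mat a b c d) = mat-≡ (left a b) (right a b) (left c d) (right c d)
    where
    left : ∀ x y → x * (- + 1) + y * + 0 ≡ - x
    left = solve-∀
    right : ∀ x y → x * + 0 + y * (- + 1) ≡ - y
    right = solve-∀

  -- M Uᵏ M⁻¹ for any M ∈ SL₂(ℤ) with first column (a, c)
  parabolic : ℤ → ℤ → ℤ → M2
  parabolic a c k = mat (+ 1 - k * a * c) (k * a * a) (- (k * c * c)) (+ 1 + k * a * c)

  conj-Upow : ∀ M n → SL2 M → M · Upow n · adj M ≡ parabolic (M2.a M) (M2.c M) (+ n)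
  conj-Upow (mat a b c d) n det≡1 =
    mat-≡ (trans (upper a b c d (+ n)) (cong (_- + n * a * c) det≡1)) (corner a b (+ n))
          (corner′ c d (+ n)) (trans (lower a b c d (+ n)) (cong (_+ + n * a * c) det≡1))
    where
    upper : ∀ a b c d k → (a * + 1 + b * + 0) * d + (a * k + b * + 1) * (- c) ≡ a * d - b * c - k * a * c
    upper = solve-∀
    corner : ∀ a b k → (a * + 1 + b * + 0) * (- b) + (a * k + b * + 1) * a ≡ k * a * a
    corner = solve-∀
    corner′ : ∀ c d k → (c * + 1 + d * + 0) * d + (c * k + d * + 1) * (- c) ≡ - (k * c * c)
    corner′ = solve-∀
    lower : ∀ a b c d k → (c * + 1 + d * + 0) * (- b) + (c * k + d * + 1) * a ≡ a * d - b * c + k * a * c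
    lower = solve-∀

  det-parabolic : ∀ a c k → SL2 (parabolic a c k)
  det-parabolic a c k = unimodular a c k
    where
    unimodular : ∀ a c k → (+ 1 - k * a * c) * (+ 1 + k * a * c) - k * a * a * (- (k * c * c)) ≡ + 1
    unimodular = solve-∀

  parabolic-+ : ∀ a c k l → parabolic a c k · parabolic a c l ≡ parabolic a c (k + l)
  parabolic-+ a c k l = mat-≡ (e₁₁ a c k l) (e₁₂ a c k l) (e₂₁ a c k l) (e₂₂ a c k l)
    where
    e₁₁ : ∀ a c k l → (+ 1 - k * a * c) * (+ 1 - l * a * c) + k * a * a * (- (l * c * c)) ≡ + 1 - (k + l) * a * c
    e₁₁ = solve-∀
    e₁₂ : ∀ a c k l → (+ 1 - k * a * c) * (l * a * a) + k * a * a * (+ 1 + l * a * c) ≡ (k + l) * a * a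
    e₁₂ = solve-∀
    e₂₁ : ∀ a c k l → - (k * c * c) * (+ 1 - l * a * c) + (+ 1 + k * a * c) * (- (l * c * c)) ≡ - ((k + l) * c * c)
    e₂₁ = solve-∀
    e₂₂ : ∀ a c k l → - (k * c * c) * (l * a * a) + (+ 1 + k * a * c) * (+ 1 + l * a * c) ≡ + 1 + (k + l) * a * c
    e₂₂ = solve-∀

  adj-parabolic : ∀ a c k → adj (parabolic a c k) ≡ parabolic a c (- k)
  adj-parabolic a c k = mat-≡ (e₁₁ a c k) (e₁₂ a c k) (e₂₁ a c k) (e₂₂ a c k)
    where
    e₁₁ : ∀ a c k → + 1 + k * a * c ≡ + 1 - (- k) * a * c
    e₁₁ = solve-∀
    e₁₂ : ∀ a c k → - (k * a * a) ≡ (- k) * a * a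
    e₁₂ = solve-∀
    e₂₁ : ∀ a c k → - (- (k * c * c)) ≡ - ((- k) * c * c)
    e₂₁ = solve-∀
    e₂₂ : ∀ a c k → + 1 - k * a * c ≡ + 1 + (- k) * a * c
    e₂₂ = solve-∀

  parabolic-scale : ∀ s a c k → parabolic (s * a) (s * c) k ≡ parabolic a c (s * s * k)
  parabolic-scale s a c k = mat-≡ (e₁₁ s a c k) (e₁₂ s a c k) (e₂₁ s a c k) (e₂₂ s a c k)
    where
    e₁₁ : ∀ s a c k → + 1 - k * (s * a) * (s * c) ≡ + 1 - s * s * k * a * c
    e₁₁ = solve-∀
    e₁₂ : ∀ s a c k → k * (s * a) * (s * a) ≡ s * s * k * a * a
    e₁₂ = solve-∀
    e₂₁ : ∀ s a c k → - (k * (s * c) * (s * c)) ≡ - (s * s * k * c * c)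
    e₂₁ = solve-∀
    e₂₂ : ∀ s a c k → + 1 + k * (s * a) * (s * c) ≡ + 1 + s * s * k * a * c
    e₂₂ = solve-∀

  Amat-parabolic : ∀ p a c k → Amat p · parabolic a c (+ p * k) ≡ parabolic (+ p * a) c k · Amat p
  Amat-parabolic p a c k = mat-≡ (e₁₁ (+ p) a c k) (e₁₂ (+ p) a c k) (e₂₁ (+ p) a c k) (e₂₂ (+ p) a c k)
    where
    e₁₁ : ∀ s a c k → s * (+ 1 - s * k * a * c) + + 0 * (- (s * k * c * c))
                      ≡ (+ 1 - k * (s * a) * c) * s + k * (s * a) * (s * a) * + 0
    e₁₁ = solve-∀
    e₁₂ : ∀ s a c k → s * (s * k * a * a) + + 0 * (+ 1 + s * k * a * c)
                      ≡ (+ 1 - k * (s * a) * c) * + 0 + k * (s * a) * (s * a) * + 1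
    e₁₂ = solve-∀
    e₂₁ : ∀ s a c k → + 0 * (+ 1 - s * k * a * c) + + 1 * (- (s * k * c * c))
                      ≡ - (k * c * c) * s + (+ 1 + k * (s * a) * c) * + 0
    e₂₁ = solve-∀
    e₂₂ : ∀ s a c k → + 0 * (s * k * a * a) + + 1 * (+ 1 + s * k * a * c)
                      ≡ - (k * c * c) * + 0 + (+ 1 + k * (s * a) * c) * + 1
    e₂₂ = solve-∀

  ·-Amat-cancelʳ : ∀ p .{{_ : ℕ.NonZero p}} {g h} → g · Amat p ≡ h · Amat p → g ≡ h
  ·-Amat-cancelʳ p {mat ga gb gc gd} {mat ha hb hc hd} eq =
    mat-≡ (*-cancelʳ-≡ ga ha (+ p) (trans (sym (left (+ p) ga gb)) (trans (cong M2.a eq) (left (+ p) ha hb))))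
          (trans (sym (right ga gb)) (trans (cong M2.b eq) (right ha hb)))
          (*-cancelʳ-≡ gc hc (+ p) (trans (sym (left (+ p) gc gd)) (trans (cong M2.c eq) (left (+ p) hc hd))))
          (trans (sym (right gc gd)) (trans (cong M2.d eq) (right hc hd)))
    where
    left : ∀ s x y → x * s + y * + 0 ≡ x * s
    left = solve-∀
    right : ∀ x y → x * + 0 + y * + 1 ≡ y
    right = solve-∀

  det-completion-coprime : ∀ s a b c d u t → SL2 (mat a b c d) → s * u + c * t ≡ + 1 →
                           SL2 (mat (s * a) (s * u * b - t) c (d * u))
  det-completion-coprime s a b c d u t det≡1 bézout = begin
    s * a * (d * u) - (s * u * b - t) * c  ≡⟨ expand s a b c d u t ⟩
    s * u * (a * d - b * c) + c * t        ≡⟨ cong (λ δ → s * u * δ + c * t) det≡1 ⟩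
    s * u * + 1 + c * t                    ≡⟨ cong (_+ c * t) (*-identityʳ (s * u)) ⟩
    s * u + c * t                          ≡⟨ bézout ⟩
    + 1                                    ∎
    where
    expand : ∀ s a b c d u t → s * a * (d * u) - (s * u * b - t) * c ≡ s * u * (a * d - b * c) + c * t
    expand = solve-∀

  det-completion-divisible : ∀ s a b c d → SL2 (mat a b (s * c) d) → SL2 (mat a (s * b) c d)
  det-completion-divisible s a b c d = trans (regroup s a b c d)
    where
    regroup : ∀ s a b c d → a * d - s * b * c ≡ a * d - b * (s * c)
    regroup = solve-∀

  private
    from-ℕ : ∀ x m y n → 1 ℕ.+ y ℕ.* n ≡ x ℕ.* m → + 1 + + y * + n ≡ + x * + m
    from-ℕ x m y n eq = trans (cong (λ j → + 1 + j) (sym (pos-* y n))) (trans (cong +_ eq) (pos-* x m))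

    difference-one : ∀ {i j} → + 1 + j ≡ i → i - j ≡ + 1
    difference-one {i} {j} e = trans (cong (_- j) (sym e)) (cancel (+ 1) j)
      where
      cancel : ∀ i j → i + j - j ≡ i
      cancel = solve-∀

  bézout-ℤ : ∀ {m n} → Bézout.Identity 1 m n → ∃₂ λ u t → + m * u + + n * t ≡ + 1
  bézout-ℤ {m} {n} (Bézout.+- x y eq) =
    + x , - + y , trans (rearrange (+ m) (+ n) (+ x) (+ y)) (difference-one (from-ℕ x m y n eq))
    where
    rearrange : ∀ m n x y → m * x + n * (- y) ≡ x * m - y * n
    rearrange = solve-∀
  bézout-ℤ {m} {n} (Bézout.-+ x y eq) =
    - + x , + y , trans (rearrange (+ m) (+ n) (+ x) (+ y)) (difference-one (from-ℕ y n x m eq))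
    where
    rearrange : ∀ m n x y → m * (- x) + n * y ≡ y * n - x * m
    rearrange = solve-∀

  prime∤⇒coprime : ∀ {p n} → Prime p → ¬ p ∣ n → Coprime p n
  prime∤⇒coprime p-prime p∤n (d∣p , d∣n) with prime⇒irreducible p-prime d∣p
  ... | inj₁ d≡1 = d≡1
  ... | inj₂ refl = ⊥-elim (p∤n d∣n)

  prime∤⇒bézout : ∀ {p c} → Prime p → ¬ p ∣ ∣ c ∣ → ∃₂ λ u t → + p * u + c * t ≡ + 1
  prime∤⇒bézout {c = + n} p-prime p∤c = bézout-ℤ (coprime-Bézout (prime∤⇒coprime p-prime p∤c))
  prime∤⇒bézout {p} {c = -[1+ n ]} p-prime p∤c =
    let u , t , eq = bézout-ℤ (coprime-Bézout (prime∤⇒coprime p-prime p∤c))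
    in u , - t , trans (negate-both (+ p) u (+ ℕ.suc n) t) eq
    where
    negate-both : ∀ s u c t → s * u + (- c) * (- t) ≡ s * u + c * t
    negate-both = solve-∀

  ∣abs⇒multiple : ∀ {p c} → p ∣ ∣ c ∣ → ∃ λ c′ → c ≡ + p * c′
  ∣abs⇒multiple {p} {c} p∣c =
    let open Signed._∣_ (Signed.∣ᵤ⇒∣ {+ p} {c} p∣c) in quotient , trans equality (*-comm quotient (+ p))

open IntegerAlgebra
open import Data.Nat using (ℕ; _*_)
open import Data.Nat.Base using (zero; suc; _<_; _∸_; NonZero; >-nonZero; >-nonZero⁻¹)
open import Data.Nat.Properties using (_≟_; *-comm; *-mono-<; n≢0⇒n>0)
open import Data.Nat.Divisibility using (divides; _∣?_; m%n≡0⇒n∣m)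
open import Data.Nat.DivMod using (_%_; _/_; m%n≡m∸m/n*n; m/n*n≤m; m%n<n)
open import Data.Nat.Induction using (<-rec)
open import Data.Nat.Primality using (prime⇒nonZero)
open import Data.Integer.Properties using (m-n≡m⊖n; ⊖-≥)
open import Data.Product using (_×_)
open import Relation.Nullary.Decidable using (decidable-stable; ¬¬-excluded-middle)

LeastPositive : (ℕ → Set) → ℕ → Set
LeastPositive Q w = 0 < w × Q w × (∀ k → 0 < k → k < w → ¬ Q k)

¬¬-least : ∀ {Q : ℕ → Set} j → 0 < j → Q j → ¬ ¬ ∃ (LeastPositive Q)
¬¬-least {Q} = <-rec (λ j → 0 < j → Q j → ¬ ¬ ∃ (LeastPositive Q)) step
  where
  step : ∀ j → (∀ {i} → i < j → 0 < i → Q i → ¬ ¬ ∃ (LeastPositive Q)) → 0 < j → Q j → ¬ ¬ ∃ (LeastPositive Q)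
  step j below 0<j Qj ¬least = ¬¬-excluded-middle {A = ∃ λ i → i < j × 0 < i × Q i} λ where
    (yes (i , i<j , 0<i , Qi)) → below i<j 0<i Qi ¬least
    (no none-below) → ¬least (j , 0<j , Qj , λ k 0<k k<j Qk → none-below (k , k<j , 0<k , Qk))

module Subgroup {G : M2 → Set} (G-sub : IsSubgroupSL2 G) where

  I∈G : G I
  I∈G = proj₁ (proj₂ G-sub)

  ·-closed : ∀ g h → G g → G h → G (g · h)
  ·-closed = proj₁ (proj₂ (proj₂ G-sub))

  adj-closed : ∀ g → G g → G (adj g)
  adj-closed = proj₂ (proj₂ (proj₂ G-sub))

  neg-cancel : G (neg I) → ∀ {g} → G (neg g) → G g
  neg-cancel negI∈G {g} neg-g∈G = subst G (neg-I-·-neg g) (·-closed _ _ negI∈G neg-g∈G)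

  parabolic-pow : ∀ a c {k} → G (parabolic a c (+ k)) → ∀ q → G (parabolic a c (+ (q * k)))
  parabolic-pow a c X∈G zero = I∈G
  parabolic-pow a c {k} X∈G (suc q) =
    subst G (parabolic-+ a c (+ k) (+ (q * k))) (·-closed _ _ X∈G (parabolic-pow a c X∈G q))

  parabolic-% : ∀ a c {m n} .{{_ : NonZero m}} →
                G (parabolic a c (+ m)) → G (parabolic a c (+ n)) → G (parabolic a c (+ (n % m)))
  parabolic-% a c {m} {n} Xm∈G Xn∈G =
    subst G Xn·Xqm⁻¹≡Xr (·-closed _ _ Xn∈G (adj-closed _ (parabolic-pow a c Xm∈G (n / m))))
    where
    Xn·Xqm⁻¹≡Xr : parabolic a c (+ n) · adj (parabolic a c (+ (n / m * m))) ≡ parabolic a c (+ (n % m))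
    Xn·Xqm⁻¹≡Xr = begin
      parabolic a c (+ n) · adj (parabolic a c (+ (n / m * m)))
        ≡⟨ cong (parabolic a c (+ n) ·_) (adj-parabolic a c (+ (n / m * m))) ⟩
      parabolic a c (+ n) · parabolic a c (ℤ.- + (n / m * m))
        ≡⟨ parabolic-+ a c (+ n) (ℤ.- + (n / m * m)) ⟩
      parabolic a c (+ n ℤ.- + (n / m * m))
        ≡⟨ cong (parabolic a c) (trans (m-n≡m⊖n n (n / m * m)) (⊖-≥ (m/n*n≤m n m))) ⟩
      parabolic a c (+ (n ∸ n / m * m))
        ≡⟨ cong (parabolic a c ∘ +_) (m%n≡m∸m/n*n n m) ⟨
      parabolic a c (+ (n % m)) ∎

  widthCond⇒parabolic : G (neg I) → ∀ M {n} → SL2 M → WidthCond G M n →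
                        G (parabolic (M2.a M) (M2.c M) (+ n))
  widthCond⇒parabolic _ M {n} M∈SL2 (inj₁ conj∈G) = subst G (conj-Upow M n M∈SL2) conj∈G
  widthCond⇒parabolic negI∈G M {n} M∈SL2 (inj₂ neg-conj∈G) =
    subst G (conj-Upow M n M∈SL2) (neg-cancel negI∈G neg-conj∈G)

  parabolic⇒widthCond : ∀ M {n} → SL2 M → G (parabolic (M2.a M) (M2.c M) (+ n)) → WidthCond G M n
  parabolic⇒widthCond M {n} M∈SL2 X∈G = inj₁ (subst G (sym (conj-Upow M n M∈SL2)) X∈G)

  least-parabolic-∣ : ∀ a c {m n} .{{_ : NonZero m}} →
                      G (parabolic a c (+ m)) → (∀ k → 0 < k → k < m → ¬ G (parabolic a c (+ k))) →
                      G (parabolic a c (+ n)) → m ∣ n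
  least-parabolic-∣ a c {m} {n} Xm∈G minimal Xn∈G with n % m ≟ 0
  ... | yes r≡0 = m%n≡0⇒n∣m n m r≡0
  ... | no r≢0 = ⊥-elim (minimal (n % m) (n≢0⇒n>0 r≢0) (m%n<n n m) (parabolic-% a c Xm∈G Xn∈G))

  cuspWidth-∣ : G (neg I) → ∀ M {m n} → SL2 M → IsCuspWidth G M m →
                G (parabolic (M2.a M) (M2.c M) (+ n)) → m ∣ n
  cuspWidth-∣ negI∈G M M∈SL2 (0<m , cond , minimal) =
    least-parabolic-∣ (M2.a M) (M2.c M) {{>-nonZero 0<m}} (widthCond⇒parabolic negI∈G M M∈SL2 cond)
      (λ k 0<k k<m Xk∈G → minimal k 0<k k<m (parabolic⇒widthCond M M∈SL2 Xk∈G))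

  cuspWidth-level : G (neg I) → ∀ {N} → (∀ M m → SL2 M → IsCuspWidth G M m → m ∣ N) →
                    ∀ M {j} → SL2 M → 0 < j → G (parabolic (M2.a M) (M2.c M) (+ j)) →
                    ¬ ¬ G (parabolic (M2.a M) (M2.c M) (+ N))
  cuspWidth-level negI∈G {N} widths∣N M {j} M∈SL2 0<j Xj∈G ¬XN∈G =
    ¬¬-least j 0<j (parabolic⇒widthCond M M∈SL2 Xj∈G) λ (w , width@(_ , cond , _)) →
      ¬XN∈G (raise (widths∣N M w M∈SL2 width) (widthCond⇒parabolic negI∈G M M∈SL2 cond))
    where
    raise : ∀ {w} → w ∣ N → G (parabolic (M2.a M) (M2.c M) (+ w)) → G (parabolic (M2.a M) (M2.c M) (+ N))
    raise (divides q N≡qw) Xw∈G =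
      subst (λ k → G (parabolic (M2.a M) (M2.c M) (+ k))) (sym N≡qw) (parabolic-pow (M2.a M) (M2.c M) Xw∈G q)

open Subgroup

conjInter-isSubgroup : ∀ p {H} → IsSubgroupSL2 H → IsSubgroupSL2 (ConjInter p H)
conjInter-isSubgroup p {H} (H⊆SL2 , I∈H , ·-closedH , adj-closedH) =
  (λ _ → proj₁) , (refl , I , I∈H , trans (·-identityʳ A) (sym (·-identityˡ A))) , ·-closed′ , adj-closed′
  where
  A : M2
  A = Amat p

  ·-closed′ : ∀ g g′ → ConjInter p H g → ConjInter p H g′ → ConjInter p H (g · g′)
  ·-closed′ g g′ (g∈SL2 , h , h∈H , Ag≡hA) (g′∈SL2 , h′ , h′∈H , Ag′≡h′A) =
    trans (det-· g g′) (cong₂ ℤ._*_ g∈SL2 g′∈SL2) , h · h′ , ·-closedH h h′ h∈H h′∈H , (begin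
      A · (g · g′)   ≡⟨ ·-assoc A g g′ ⟨
      (A · g) · g′   ≡⟨ cong (_· g′) Ag≡hA ⟩
      (h · A) · g′   ≡⟨ ·-assoc h A g′ ⟩
      h · (A · g′)   ≡⟨ cong (h ·_) Ag′≡h′A ⟩
      h · (h′ · A)   ≡⟨ ·-assoc h h′ A ⟨
      (h · h′) · A   ∎)

  adj-closed′ : ∀ g → ConjInter p H g → ConjInter p H (adj g)
  adj-closed′ g (g∈SL2 , h , h∈H , Ag≡hA) =
    trans (det-adj g) g∈SL2 , adj h , adj-closedH h h∈H , (begin
      A · adj g                    ≡⟨ ·-identityˡ (A · adj g) ⟨
      I · (A · adj g)              ≡⟨ cong (_· (A · adj g)) (adj-·ˡ h (H⊆SL2 h h∈H)) ⟨
      (adj h · h) · (A · adj g)    ≡⟨ ·-assoc (adj h) h (A · adj g) ⟩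
      adj h · (h · (A · adj g))    ≡⟨ cong (adj h ·_) (·-assoc h A (adj g)) ⟨
      adj h · ((h · A) · adj g)    ≡⟨ cong (λ x → adj h · (x · adj g)) Ag≡hA ⟨
      adj h · ((A · g) · adj g)    ≡⟨ cong (adj h ·_) (·-assoc A g (adj g)) ⟩
      adj h · (A · (g · adj g))    ≡⟨ cong (λ x → adj h · (A · x)) (·-adjʳ g g∈SL2) ⟩
      adj h · (A · I)              ≡⟨ cong (adj h ·_) (·-identityʳ A) ⟩
      adj h · A                    ∎)

conjInter-neg-I : ∀ p {H} → H (neg I) → ConjInter p H (neg I)
conjInter-neg-I p negI∈H = refl , neg I , negI∈H , trans (·-neg-I (Amat p)) (sym (neg-I-· (Amat p)))

conjInter-parabolic⁺ : ∀ p {H} a c k →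
                       H (parabolic (+ p ℤ.* a) c (+ k)) → ConjInter p H (parabolic a c (+ (p * k)))
conjInter-parabolic⁺ p {H} a c k X∈H =
  subst (ConjInter p H ∘ parabolic a c) (sym (pos-* p k))
    (det-parabolic a c (+ p ℤ.* + k) , parabolic (+ p ℤ.* a) c (+ k) , X∈H , Amat-parabolic p a c (+ k))

conjInter-parabolic⁻ : ∀ p .{{_ : NonZero p}} {H} a c k →
                       ConjInter p H (parabolic a c (+ (p * k))) → H (parabolic (+ p ℤ.* a) c (+ k))
conjInter-parabolic⁻ p {H} a c k (_ , h , h∈H , A·X≡h·A) =
  subst H (·-Amat-cancelʳ p (trans (sym A·X≡h·A) A·X≡X′·A)) h∈H
  where
  A·X≡X′·A : Amat p · parabolic a c (+ (p * k)) ≡ parabolic (+ p ℤ.* a) c (+ k) · Amat p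
  A·X≡X′·A = subst (λ k′ → Amat p · parabolic a c k′ ≡ parabolic (+ p ℤ.* a) c (+ k) · Amat p)
                   (sym (pos-* p k)) (Amat-parabolic p a c (+ k))

level-at-p-column : ∀ {p} → Prime p → ∀ {H} → IsSubgroupSL2 H → H (neg I) →
                    ∀ {N} → (∀ M m → SL2 M → IsCuspWidth H M m → m ∣ N) →
                    ∀ M {m} → SL2 M → 0 < m →
                    H (parabolic (+ p ℤ.* M2.a M) (M2.c M) (+ m)) →
                    ¬ ¬ H (parabolic (+ p ℤ.* M2.a M) (M2.c M) (+ N))
level-at-p-column {p} p-prime {H} H-sub negI∈H {N} widths∣N (mat a b c d) {m} M∈SL2 0<m X∈H with p ∣? ∣ c ∣
... | no p∤c =
  let u , t , bézout = prime∤⇒bézout {c = c} p-prime p∤c in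
  cuspWidth-level H-sub negI∈H widths∣N (mat (+ p ℤ.* a) (+ p ℤ.* u ℤ.* b ℤ.- t) c (d ℤ.* u))
    (det-completion-coprime (+ p) a b c d u t M∈SL2 bézout) 0<m X∈H
... | yes p∣c with ∣abs⇒multiple {p} {c} p∣c
... | c′ , refl = λ ¬XN∈H →
  cuspWidth-level H-sub negI∈H widths∣N (mat a (+ p ℤ.* b) c′ d)
    (det-completion-divisible (+ p) a b c′ d M∈SL2) 0<p²m (subst H (scale m) X∈H)
    λ XN∈H → ¬XN∈H (subst H (sym (scale N)) (parabolic-pow H-sub a c′ XN∈H (p * p)))
  where
  0<p²m : 0 < p * p * m
  0<p²m = let 0<p = >-nonZero⁻¹ p {{prime⇒nonZero p-prime}} in *-mono-< (*-mono-< 0<p 0<p) 0<m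
  scale : ∀ k → parabolic (+ p ℤ.* a) (+ p ℤ.* c′) (+ k) ≡ parabolic a c′ (+ (p * p * k))
  scale k = trans (parabolic-scale (+ p) a c′ (+ k))
                  (cong (parabolic a c′) (sym (trans (pos-* (p * p) k) (cong (ℤ._* + k) (pos-* p p)))))

lemma4p5 : (p : ℕ) → Prime p → (H : M2 → Set) → IsSubgroupSL2 H → FiniteIndex H →
    H (neg I) → (N : ℕ) → IsWohlfahrtLevel H N →
    (L : ℕ) → IsWohlfahrtLevel (ConjInter p H) L → L ∣ N * p
-- Finite index only guarantees that the levels N and L exist; here they are given.
lemma4p5 p p-prime H H-sub _ negI∈H N (widths∣N , _) L (_ , L∣common-multiples) =
  L∣common-multiples (N * p) widths∣Np
  where
  instance
    p≢0 : NonZero p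
    p≢0 = prime⇒nonZero p-prime

  G-sub : IsSubgroupSL2 (ConjInter p H)
  G-sub = conjInter-isSubgroup p H-sub

  negI∈G : ConjInter p H (neg I)
  negI∈G = conjInter-neg-I p negI∈H

  widths∣Np : ∀ M m → SL2 M → IsCuspWidth (ConjInter p H) M m → m ∣ N * p
  widths∣Np M m M∈SL2 width@(0<m , cond , _) =
    decidable-stable (m ∣? N * p) λ m∤Np →
      level-at-p-column p-prime H-sub negI∈H widths∣N M M∈SL2 0<m X′m∈H λ X′N∈H →
        m∤Np (subst (m ∣_) (*-comm p N)
          (cuspWidth-∣ G-sub negI∈G M M∈SL2 width (conjInter-parabolic⁺ p (M2.a M) (M2.c M) N X′N∈H)))
    where
    X′m∈H : H (parabolic (+ p ℤ.* M2.a M) (M2.c M) (+ m))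
    X′m∈H = conjInter-parabolic⁻ p (M2.a M) (M2.c M) m
              (parabolic-pow G-sub (M2.a M) (M2.c M) (widthCond⇒parabolic G-sub negI∈G M M∈SL2 cond) p)
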